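{- For every context-free cowordism grammar $G$ there exists a simple context-free cowordism grammar $G'$ with $L(G')=L(G)$.
   Context: Cowordisms over a finite alphabet $T$: a boundary $X$ is $|X|\in\mathbb N$ with a subset $X_l\subseteq\{1,\dots,|X|\}$ of left endpoints, $X_r$ its complement; $X\otimes Y$ has cardinality $|X|+|Y|$ and left set $X_l\cup\{|X|+i:i\in Y_l\}$; $\mathbf 1$ has cardinality $0$; $X^\perp$ has cardinality $|X|$ and left set $\{|X|+1-i:i\in X_r\}$. A multiword with boundary $X$ is a perfect matching of $\{1,\dots,|X|\}$ by edges $(i,w,j)$, $w\in T^*$, from left to right endpoints, together with a finite multiset of cyclic words (singular part); it is regular if the singular part is empty. A cowordism $X\to Y$ is a multiword with boundary $Y\otimes X^\perp$. Composition of $\sigma:X\to Y$, $\tau:Y\to Z$ glues vertex $i$ of $\sigma$ to vertex $|Z|+|Y|+1-i$ of $\tau$, making maximal paths into edges labelled by concatenated labels and closed cycles into cyclic words. Tensor of $\sigma:X\to Y$ and $\tau:Z\to W$ is the multiword with boundary $Y\otimes W\otimes Z^\perp\otimes X^\perp$ containing the edges of $\sigma$ (vertex $i\mapsto i$ if $i\le|Y|$, else $i+|W|+|Z|$) and of $\tau$ (shifted by $|Y|$). The pattern $Pat(\sigma)$ of a cowordism is obtained by replacing every edge label by the empty word. Context-free cowordism grammar: $G=(N,T,P,S)$ with $N$ a finite set of types, each $A\in N$ assigned a boundary $[A]$; $T$ a finite alphabet; $P$ a finite set of productions, each given by types $A_1,\dots,A_n,A$ ($n\ge0$) and a cowordism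 $\sigma:[A_1]\otimes\dots\otimes[A_n]\to[A]$ over $T$; $S\in N$ with $|[S]|=2$, $[S]_l=\{1\}$. Generated cowordisms: if $\sigma:A_1\otimes\dots\otimes A_n\to A$ is in $P$ and $\vdash_G\tau_i:A_i$ for $i=1,\dots,n$, then $\vdash_G\sigma\circ(\tau_1\otimes\dots\otimes\tau_n):A$ (for $n=0$, $\vdash_G\sigma:A$). The language $L(G)$ is the set of words $w$ such that the regular cowordism $\mathbf 1\to[S]$ with single edge $(1,w,2)$ is generated of type $S$. $G$ is simple if for every $A\in N$ the set $\{Pat(\sigma):\sigma\text{ regular}, \vdash_G\sigma:A\}$ has at most one element. -}

module Defs where

open import Data.Nat using (ℕ; zero; suc; _+_; _∸_; _≤ᵇ_; _≡ᵇ_; _<ᵇ_)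
open import Data.Bool using (Bool; true; false; not; if_then_else_)
open import Data.Fin using (Fin)
open import Data.List using (List; []; _∷_; _++_; map; upTo; foldr; mapMaybe)
open import Data.List.Relation.Unary.All using (All)
open import Data.List.Relation.Binary.Pointwise using (Pointwise)
open import Data.List.Relation.Binary.Permutation.Propositional using (_↭_)
open import Data.List.Membership.Propositional using (_∈_)
open import Data.Maybe using (Maybe; just; nothing)
open import Data.Product using (Σ; _×_; _,_; ∃; ∃₂)
open import Data.Sum using (_⊎_; inj₁; inj₂)
open import Relation.Binary.PropositionalEquality using (_≡_)
open import Function.Bundles using (_⇔_)

-- Boundaries.  Endpoints are numbered 1,…,size (as in the paper);
-- isLeft k says whether k ∈ X_l (values outside 1..size are irrelevant).

record Boundary : Set where
  constructor mkBoundary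
  field
    size   : ℕ
    isLeft : ℕ → Bool
open Boundary public

_⊗_ : Boundary → Boundary → Boundary
X ⊗ Y = mkBoundary (size X + size Y)
          (λ k → if k ≤ᵇ size X then isLeft X k else isLeft Y (k ∸ size X))

𝟏 : Boundary
𝟏 = mkBoundary 0 (λ _ → false)

_^⊥ : Boundary → Boundary
X ^⊥ = mkBoundary (size X) (λ k → not (isLeft X (suc (size X) ∸ k)))

range1 : ℕ → List ℕ
range1 n = map suc (upTo n)

-- Multiwords over an alphabet T.  An edge (i , w , j) goes from the
-- left endpoint i to the right endpoint j and is labelled by w ∈ T*.

module _ {T : Set} where

  Word : Set
  Word = List T

  Edge : Set
  Edge = ℕ × Word × ℕ

  record Multiword : Set where
    constructor mkMW
    field
      edges    : List Edge
      singular : List Word      -- finite multiset of cyclic words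
  open Multiword public

  endpoints : List Edge → List ℕ
  endpoints = foldr (λ { (i , _ , j) rest → i ∷ j ∷ rest }) []

  IsMultiword : Boundary → Multiword → Set
  IsMultiword X μ =
    (endpoints (edges μ) ↭ range1 (size X)) ×
    All (λ { (i , _ , j) → (isLeft X i ≡ true) × (isLeft X j ≡ false) }) (edges μ)

  IsCowordism : Boundary → Boundary → Multiword → Set
  IsCowordism X Y = IsMultiword (Y ⊗ (X ^⊥))

  Regular : Multiword → Set
  Regular μ = singular μ ≡ []

  CycEq : Word → Word → Set
  CycEq u v = ∃₂ λ p q → (u ≡ p ++ q) × (v ≡ q ++ p)

  CycMultisetEq : List Word → List Word → Set
  CycMultisetEq us vs = Σ (List Word) λ ws → Pointwise CycEq us ws × (ws ↭ vs)

  _≈_ : Multiword → Multiword → Set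
  μ ≈ ν = (edges μ ↭ edges ν) × CycMultisetEq (singular μ) (singular ν)

  Pat : Multiword → Multiword
  Pat μ = mkMW (map (λ { (i , _ , j) → (i , [] , j) }) (edges μ)) (singular μ)

  outEdge : List Edge → ℕ → Maybe (Word × ℕ)
  outEdge [] i = nothing
  outEdge ((a , w , b) ∷ es) i = if a ≡ᵇ i then just (w , b) else outEdge es i

  -- Composition of σ : X → Y and τ : Y → Z (x = |X|, y = |Y|, z = |Z|).
  -- Vertex i ≤ y of σ is glued to vertex z+y+1-i of τ.  Vertices of the
  -- result (boundary Z ⊗ X^⊥): r ≤ z is vertex r of τ, r > z is vertex
  -- y+(r-z) of σ.  Locations: inj₁ r = result vertex r, inj₂ g = glued
  -- point g (σ-vertex g, 1 ≤ g ≤ y).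

  module Compose (x y z : ℕ) (σ τ : Multiword) where

    Loc : Set
    Loc = ℕ ⊎ ℕ

    classσ : ℕ → Loc
    classσ s = if s ≤ᵇ y then inj₂ s else inj₁ (z + (s ∸ y))

    classτ : ℕ → Loc
    classτ t = if t ≤ᵇ z then inj₁ t else inj₂ (suc (z + y) ∸ t)

    mapLoc : (ℕ → Loc) → Maybe (Word × ℕ) → Maybe (Word × Loc)
    mapLoc f nothing = nothing
    mapLoc f (just (w , v)) = just (w , f v)

    stepG : ℕ → Maybe (Word × Loc)
    stepG g with outEdge (edges σ) g
    ... | just (w , s) = just (w , classσ s)
    ... | nothing = mapLoc classτ (outEdge (edges τ) (suc (z + y) ∸ g))

    startR : ℕ → Maybe (Word × Loc)
    startR r = if r ≤ᵇ z then mapLoc classτ (outEdge (edges τ) r)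
                         else mapLoc classσ (outEdge (edges σ) (y + (r ∸ z)))

    follow : ℕ → Word → Loc → Maybe (Word × ℕ)
    follow _ acc (inj₁ r) = just (acc , r)
    follow zero acc (inj₂ g) = nothing
    follow (suc f) acc (inj₂ g) with stepG g
    ... | nothing = nothing
    ... | just (w , l) = follow f (acc ++ w) l

    pathFrom : ℕ → Maybe Edge
    pathFrom r with startR r
    ... | nothing = nothing
    ... | just (w , l) with follow (suc y) w l
    ...   | nothing = nothing
    ...   | just (w' , r') = just (r , w' , r')

    -- the cyclic word of the closed cycle through glued point g0, reported
    -- only when g0 is the least glued point on it (each cycle once)
    cyc : ℕ → ℕ → Word → ℕ → Maybe Word
    cyc zero g0 acc g = nothing
    cyc (suc f) g0 acc g with stepG g
    ... | nothing = nothing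
    ... | just (w , inj₁ _) = nothing
    ... | just (w , inj₂ g') =
          if g' ≡ᵇ g0 then just (acc ++ w)
          else (if g' <ᵇ g0 then nothing else cyc f g0 (acc ++ w) g')

    result : Multiword
    result = mkMW (mapMaybe pathFrom (range1 (z + x)))
                  (singular σ ++ singular τ ++
                     mapMaybe (λ g → cyc y g [] g) (range1 y))

  compose : (x y z : ℕ) → Multiword → Multiword → Multiword
  compose x y z σ τ = Compose.result x y z σ τ

  -- Tensor of σ : X → Y and τ : Z → W (boundary Y ⊗ W ⊗ Z^⊥ ⊗ X^⊥).

  mapEdge : (ℕ → ℕ) → Edge → Edge
  mapEdge f (i , w , j) = (f i , w , f j)

  tensor : (x y z w : ℕ) → Multiword → Multiword → Multiword
  tensor x y z w σ τ =
    mkMW (map (mapEdge (λ i → if i ≤ᵇ y then i else i + w + z)) (edges σ) ++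
          map (mapEdge (λ i → y + i)) (edges τ))
         (singular σ ++ singular τ)

  emptyMW : Multiword
  emptyMW = mkMW [] []

tensorB : {k : ℕ} → (Fin k → Boundary) → List (Fin k) → Boundary
tensorB B [] = 𝟏
tensorB B (A ∷ As) = B A ⊗ tensorB B As

record Production (t k : ℕ) (B : Fin k → Boundary) : Set where
  field
    args   : List (Fin k)
    target : Fin k
    cow    : Multiword {Fin t}
    isCow  : IsCowordism (tensorB B args) (B target) cow
open Production public

record Grammar (t : ℕ) : Set where
  field
    nTypes    : ℕ
    bnd       : Fin nTypes → Boundary
    prods     : List (Production t nTypes bnd)
    start     : Fin nTypes
    startSize : size (bnd start) ≡ 2
    start1    : isLeft (bnd start) 1 ≡ true
    start2    : isLeft (bnd start) 2 ≡ false
open Grammar public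

module _ {t : ℕ} (G : Grammar t) where

  tensorAll : List (Fin (nTypes G)) → List (Multiword {Fin t}) → Multiword
  tensorAll (A ∷ As) (τ ∷ τs) =
    tensor 0 (size (bnd G A)) 0 (size (tensorB (bnd G) As)) τ (tensorAll As τs)
  tensorAll _ _ = emptyMW

  data Gen : Fin (nTypes G) → Multiword {Fin t} → Set where
    gen : (p : Production t (nTypes G) (bnd G)) → p ∈ prods G →
          (τs : List (Multiword {Fin t})) →
          Pointwise Gen (args p) τs →
          Gen (target p)
              (compose 0 (size (tensorB (bnd G) (args p))) (size (bnd G (target p)))
                       (tensorAll (args p) τs) (cow p))

  singleEdge : List (Fin t) → Multiword {Fin t}
  singleEdge w = mkMW ((1 , w , 2) ∷ []) []

  InLanguage : List (Fin t) → Set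
  InLanguage w = ∃ λ σ → Gen (start G) σ × (σ ≈ singleEdge w)

  Simple : Set
  Simple = ∀ A σ σ' → Gen A σ → Gen A σ' → Regular σ → Regular σ' →
           Pat σ ≈ Pat σ'

-- Refine every type A of G into pairs (A , s), where s is the shape (edges with labels erased) of the
-- cowordisms derived. The shape of σ ∘ (τ₁ ⊗ … ⊗ τₙ) depends only on the shapes of σ and of the τᵢ,
-- so for each production and each choice of argument shapes the target shape can be computed once, on
-- label-free representatives. Then every refined type fixes the shape of all it derives, derivations of
-- G lift to the refinement, and refined derivations project back. Finitely many shapes suffice: a
-- cowordism of type A has at most |A| edges with endpoints ≤ |A|, because in a composition with the
-- tensor of the arguments every edge of that tensor ends at a glued point, so paths end in [A].

module Submission where

open import Defs
open import Data.Bool using (true; false; if_then_else_)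
open import Data.Fin using (Fin; combine; remQuot)
import Data.Fin.Properties as Fin
open import Data.List using (List; []; _∷_; [_]; _++_; map; mapMaybe; concatMap; length; upTo; allFin; lookup; cartesianProductWith)
import Data.List.Properties as List
open import Data.List.Extrema.Nat using (max; xs≤max)
open import Data.List.Membership.Propositional using (_∈_; find; lose)
open import Data.List.Membership.Propositional.Properties
  using (∈-map⁺; ∈-concatMap⁺; ∈-concatMap⁻; ∈-cartesianProductWith⁺; ∈-upTo⁺; ∈-upTo⁻; ∈-allFin)
open import Data.List.Relation.Binary.Permutation.Propositional using (↭-refl; ↭-reflexive)
import Data.List.Relation.Binary.Permutation.Propositional.Properties as ↭
open import Data.List.Relation.Binary.Pointwise using (Pointwise; []; _∷_)
open import Data.List.Relation.Unary.All as All using (All; []; _∷_)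
import Data.List.Relation.Unary.All.Properties as All
open import Data.List.Relation.Unary.Any as Any using (here; there)
open import Data.List.Relation.Unary.Any.Properties using (lookup-index)
open import Data.Maybe using (Maybe; just; nothing)
import Data.Maybe as Maybe
open import Data.Maybe.Properties using (just-injective)
open import Data.Maybe.Relation.Unary.All as MaybeAll using (just; nothing)
open import Data.Nat using (ℕ; zero; suc; _+_; _*_; _∸_; _≤_; _≤ᵇ_; _≡ᵇ_; s≤s; z≤n)
open import Data.Nat.Properties using (≤ᵇ⇒≤; ≤⇒≤ᵇ; ≤-trans; m≤m+n; +-monoʳ-≤; +-identityʳ; ≤-reflexive)
import Data.Nat.Properties as ℕ
open import Data.Product using (Σ; _×_; _,_; proj₁; proj₂; ∃)
import Data.Product.Properties as Product
open import Data.Sum using (inj₁; inj₂)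
open import Data.Unit using (⊤; tt)
open import Data.Vec using (Vec; []; _∷_; toList; fromList)
import Data.Vec.Properties as Vec
open import Data.Vec.Relation.Unary.All as VecAll using ([]; _∷_)
import Data.Vec.Relation.Unary.All.Properties as VecAll
open import Function using (_∘_)
open import Function.Bundles using (_⇔_; mk⇔)
open import Relation.Binary.Definitions using (DecidableEquality)
open import Relation.Binary.PropositionalEquality using (_≡_; refl; sym; trans; cong; cong₂; subst; subst₂; module ≡-Reasoning)
open import Relation.Nullary using (yes; no; contradiction)
open ≡-Reasoning

module _ {A : Set} where

  vectors : (k : ℕ) → List A → List (Vec A k)
  vectors zero    xs = [ [] ]
  vectors (suc k) xs = cartesianProductWith _∷_ xs (vectors k xs)

  ∈-vectors : ∀ {k xs} {v : Vec A k} → VecAll.All (_∈ xs) v → v ∈ vectors k xs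
  ∈-vectors []          = here refl
  ∈-vectors (x∈xs ∷ v∈) = ∈-cartesianProductWith⁺ _∷_ x∈xs (∈-vectors v∈)

module _ {A B : Set} (f : A → Maybe B) where

  ∈-mapMaybe⁺ : ∀ {x y xs} → x ∈ xs → f x ≡ just y → y ∈ mapMaybe f xs
  ∈-mapMaybe⁺ {xs = x ∷ xs} (here refl) fx≡y rewrite fx≡y = here refl
  ∈-mapMaybe⁺ {xs = x ∷ xs} (there x∈xs) fx≡y with f x
  ... | nothing = ∈-mapMaybe⁺ x∈xs fx≡y
  ... | just _  = there (∈-mapMaybe⁺ x∈xs fx≡y)

  ∈-mapMaybe⁻ : ∀ {y} xs → y ∈ mapMaybe f xs → ∃ λ x → x ∈ xs × f x ≡ just y
  ∈-mapMaybe⁻ (x ∷ xs) y∈ with f x in fx≡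
  ... | nothing = let x′ , x′∈ , eq = ∈-mapMaybe⁻ xs y∈ in x′ , there x′∈ , eq
  ∈-mapMaybe⁻ (x ∷ xs) (here refl) | just _ = x , here refl , fx≡
  ∈-mapMaybe⁻ (x ∷ xs) (there y∈)  | just _ =
    let x′ , x′∈ , eq = ∈-mapMaybe⁻ xs y∈ in x′ , there x′∈ , eq

module _ {A : Set} (_≟_ : DecidableEquality A) where
  open import Data.List.Membership.DecPropositional _≟_ using (_∈?_)

  indexOf : (xs : List A) → A → Maybe (Fin (length xs))
  indexOf xs a with a ∈? xs
  ... | yes a∈xs = just (Any.index a∈xs)
  ... | no _     = nothing

  lookup-indexOf : ∀ xs {a i} → indexOf xs a ≡ just i → lookup xs i ≡ a
  lookup-indexOf xs {a} eq with a ∈? xs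
  lookup-indexOf xs refl | yes a∈xs = sym (lookup-index a∈xs)

  indexOf-complete : ∀ {xs a} → a ∈ xs → ∃ λ i → indexOf xs a ≡ just i
  indexOf-complete {xs} {a} a∈xs with a ∈? xs
  ... | yes a∈xs′ = Any.index a∈xs′ , refl
  ... | no  a∉xs  = contradiction a∈xs a∉xs

range1-bounded : ∀ m → All (_≤ m) (range1 m)
range1-bounded m = All.map⁺ (All.tabulate ∈-upTo⁻)

length-range1 : ∀ m → length (range1 m) ≡ m
length-range1 m = trans (List.length-map suc (upTo m)) (List.length-upTo m)

module _ {T : Set} where

  tensorShiftˡ : ℕ → ℕ → ℕ → ℕ → ℕ
  tensorShiftˡ y z w i = if i ≤ᵇ y then i else i + w + z

  src tgt : Edge {T} → ℕ
  src (i , _ , _) = i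
  tgt (_ , _ , j) = j

  unlabel : Edge {T} → Edge {T}
  unlabel (i , _ , j) = (i , [] , j)

  shape : List (Edge {T}) → List (Edge {T})
  shape = map unlabel

  TargetsWithin : ℕ → Multiword {T} → Set
  TargetsWithin k μ = All ((_≤ k) ∘ tgt) (edges μ)

  SameShape : Multiword {T} → Multiword {T} → Set
  SameShape μ ν = shape (edges μ) ≡ shape (edges ν)

  edges-Pat : ∀ μ → edges (Pat μ) ≡ shape (edges μ)
  edges-Pat μ = go (edges μ)
    where
    go : ∀ es → edges (Pat (mkMW es (singular μ))) ≡ shape es
    go []                = refl
    go ((i , w , j) ∷ es) = cong (_ ∷_) (go es)

  shape-idem : ∀ es → shape (shape es) ≡ shape es
  shape-idem es = trans (sym (List.map-∘ es)) (List.map-cong (λ { (i , w , j) → refl }) es)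

  dest : {L : Set} → Maybe (Word {T} × L) → Maybe L
  dest = Maybe.map proj₂

  next : List (Edge {T}) → ℕ → Maybe ℕ
  next es i = dest (outEdge es i)

  next-shape : ∀ es i → next (shape es) i ≡ next es i
  next-shape []                i = refl
  next-shape ((a , w , b) ∷ es) i with a ≡ᵇ i
  ... | true  = refl
  ... | false = next-shape es i

  next-cong : ∀ μ ν → SameShape μ ν → ∀ i → next (edges μ) i ≡ next (edges ν) i
  next-cong μ ν μ≈ν i = begin
    next (edges μ) i          ≡⟨ next-shape (edges μ) i ⟨
    next (shape (edges μ)) i  ≡⟨ cong (λ es → next es i) μ≈ν ⟩
    next (shape (edges ν)) i  ≡⟨ next-shape (edges ν) i ⟩
    next (edges ν) i          ∎

  outEdge-All : ∀ {P : ℕ → Set} es → All (P ∘ tgt) es → ∀ i →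
                MaybeAll.All (P ∘ proj₂) (outEdge es i)
  outEdge-All []                 []         i = nothing
  outEdge-All ((a , w , b) ∷ es) (pb ∷ pes) i with a ≡ᵇ i
  ... | true  = just pb
  ... | false = outEdge-All es pes i

  shape-mapEdge : ∀ f es → shape (map (mapEdge f) es) ≡ map (mapEdge f) (shape es)
  shape-mapEdge f es = trans (sym (List.map-∘ es)) (trans (List.map-cong (λ { (i , u , j) → refl }) es) (List.map-∘ es))

  tensor-shape : ∀ x y z w (σ τ : Multiword {T}) →
    shape (edges (tensor x y z w σ τ)) ≡
    map (mapEdge (tensorShiftˡ y z w)) (shape (edges σ)) ++ map (mapEdge (y +_)) (shape (edges τ))
  tensor-shape x y z w σ τ =
    trans (List.map-++ unlabel (map (mapEdge (tensorShiftˡ y z w)) (edges σ)) _)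
          (cong₂ _++_ (shape-mapEdge (tensorShiftˡ y z w) (edges σ)) (shape-mapEdge (y +_) (edges τ)))

  tensor-shape-cong : ∀ x y z w (σ σ′ τ τ′ : Multiword {T}) → SameShape σ σ′ → SameShape τ τ′ →
                      SameShape (tensor x y z w σ τ) (tensor x y z w σ′ τ′)
  tensor-shape-cong x y z w σ σ′ τ τ′ σ≈ τ≈ = begin
    shape (edges (tensor x y z w σ τ))    ≡⟨ tensor-shape x y z w σ τ ⟩
    _                                     ≡⟨ cong₂ (λ a b → map _ a ++ map _ b) σ≈ τ≈ ⟩
    _                                     ≡⟨ tensor-shape x y z w σ′ τ′ ⟨
    shape (edges (tensor x y z w σ′ τ′))  ∎

  tensor-bounded : ∀ x y z w (σ τ : Multiword {T}) →
    TargetsWithin y σ → TargetsWithin w τ → TargetsWithin (y + w) (tensor x y z w σ τ)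
  tensor-bounded x y z w σ τ σ≤ τ≤ =
    All.++⁺ (All.map⁺ (All.map (λ {e} → left {e}) σ≤)) (All.map⁺ (All.map (λ {e} → right {e}) τ≤))
    where
    left : ∀ {e} → tgt e ≤ y → tgt (mapEdge (tensorShiftˡ y z w) e) ≤ y + w
    left {i , u , j} j≤y with j ≤ᵇ y | ≤⇒≤ᵇ j≤y
    ... | true  | _ = ≤-trans j≤y (m≤m+n y w)
    ... | false | ()
    right : ∀ {e} → tgt e ≤ w → tgt (mapEdge (y +_) e) ≤ y + w
    right {i , u , j} j≤w = +-monoʳ-≤ y j≤w

  module _ (x y z : ℕ) (σ σ′ τ τ′ : Multiword {T}) (σ≈ : SameShape σ σ′) (τ≈ : SameShape τ τ′) where
    private
      module C  = Compose x y z σ τ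
      module C′ = Compose x y z σ′ τ′

    mapLoc-cong : ∀ f (m m′ : Maybe (Word {T} × ℕ)) → dest m ≡ dest m′ →
                  dest (C.mapLoc f m) ≡ dest (C′.mapLoc f m′)
    mapLoc-cong f nothing  nothing  _  = refl
    mapLoc-cong f (just _) (just _) eq = cong (Maybe.map f) eq

    stepG-dest : ∀ g → dest (C.stepG g) ≡ dest (C′.stepG g)
    stepG-dest g with outEdge (edges σ) g | outEdge (edges σ′) g | next-cong σ σ′ σ≈ g
    ... | just (w , s) | just (w′ , s′) | eq = cong (λ s → just (C.classσ s)) (just-injective eq)
    ... | nothing      | nothing        | _  = mapLoc-cong C.classτ (outEdge (edges τ) g′) (outEdge (edges τ′) g′) (next-cong τ τ′ τ≈ g′)
      where g′ = suc (z + y) ∸ g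

    follow-dest : ∀ f acc acc′ l → dest (C.follow f acc l) ≡ dest (C′.follow f acc′ l)
    follow-dest f       acc acc′ (inj₁ r) = refl
    follow-dest zero    acc acc′ (inj₂ g) = refl
    follow-dest (suc f) acc acc′ (inj₂ g) with C.stepG g | C′.stepG g | stepG-dest g
    ... | nothing      | nothing         | _    = refl
    ... | just (w , l) | just (w′ , .l)  | refl = follow-dest f (acc ++ w) (acc′ ++ w′) l

    startR-dest : ∀ r → dest (C.startR r) ≡ dest (C′.startR r)
    startR-dest r with r ≤ᵇ z
    ... | true  = mapLoc-cong C.classτ (outEdge (edges τ) r) (outEdge (edges τ′) r) (next-cong τ τ′ τ≈ r)
    ... | false = mapLoc-cong C.classσ (outEdge (edges σ) s) (outEdge (edges σ′) s) (next-cong σ σ′ σ≈ s)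
      where s = y + (r ∸ z)

    pathFrom-shape : ∀ r → Maybe.map unlabel (C.pathFrom r) ≡ Maybe.map unlabel (C′.pathFrom r)
    pathFrom-shape r with C.startR r | C′.startR r | startR-dest r
    ... | nothing      | nothing        | _    = refl
    ... | just (w , l) | just (w′ , .l) | refl
        with C.follow (suc y) w l | C′.follow (suc y) w′ l | follow-dest (suc y) w w′ l
    ...   | nothing         | nothing          | _    = refl
    ...   | just (_ , r′)   | just (_ , .r′)   | refl = refl

    compose-shape-cong : SameShape (compose x y z σ τ) (compose x y z σ′ τ′)
    compose-shape-cong = begin
      map unlabel (mapMaybe C.pathFrom rs)           ≡⟨ List.map-mapMaybe unlabel C.pathFrom rs ⟩
      mapMaybe (Maybe.map unlabel ∘ C.pathFrom) rs   ≡⟨ List.mapMaybe-cong pathFrom-shape rs ⟩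
      mapMaybe (Maybe.map unlabel ∘ C′.pathFrom) rs  ≡⟨ List.map-mapMaybe unlabel C′.pathFrom rs ⟨
      map unlabel (mapMaybe C′.pathFrom rs)          ∎
      where rs = range1 (z + x)

  module _ (x y z : ℕ) (σ τ : Multiword {T}) (σ→glued : TargetsWithin y σ) where
    private
      module C = Compose x y z σ τ

    -- Every edge of σ ends at a glued point, so paths reach the boundary only through τ, at a vertex ≤ z.
    AvoidsDomain : C.Loc → Set
    AvoidsDomain (inj₁ r) = r ≤ z
    AvoidsDomain (inj₂ g) = ⊤

    classτ-avoids : ∀ t → AvoidsDomain (C.classτ t)
    classτ-avoids t with t ≤ᵇ z | ≤ᵇ⇒≤ t z
    ... | true  | t≤z = t≤z tt
    ... | false | _   = tt

    classσ-avoids : ∀ {s} → s ≤ y → AvoidsDomain (C.classσ s)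
    classσ-avoids {s} s≤y with s ≤ᵇ y | ≤⇒≤ᵇ s≤y
    ... | true  | _  = tt
    ... | false | ()

    mapLoc-avoids : ∀ {P : ℕ → Set} f → (∀ {s} → P s → AvoidsDomain (f s)) → ∀ m →
                    MaybeAll.All (P ∘ proj₂) m → MaybeAll.All (AvoidsDomain ∘ proj₂) (C.mapLoc f m)
    mapLoc-avoids f avoids nothing       nothing   = nothing
    mapLoc-avoids f avoids (just (w , s)) (just ps) = just (avoids ps)

    τ-avoids : ∀ t → MaybeAll.All (AvoidsDomain ∘ proj₂) (C.mapLoc C.classτ (outEdge (edges τ) t))
    τ-avoids t = mapLoc-avoids {λ _ → ⊤} C.classτ (λ {s} _ → classτ-avoids s) _
                   (outEdge-All (edges τ) (All.universal (λ _ → tt) (edges τ)) t)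

    σ-avoids : ∀ s → MaybeAll.All (AvoidsDomain ∘ proj₂) (C.mapLoc C.classσ (outEdge (edges σ) s))
    σ-avoids s = mapLoc-avoids C.classσ classσ-avoids _ (outEdge-All (edges σ) σ→glued s)

    stepG-avoids : ∀ g → MaybeAll.All (AvoidsDomain ∘ proj₂) (C.stepG g)
    stepG-avoids g with outEdge (edges σ) g | outEdge-All (edges σ) σ→glued g
    ... | just (w , s) | just s≤y = just (classσ-avoids s≤y)
    ... | nothing      | _        = τ-avoids (suc (z + y) ∸ g)

    startR-avoids : ∀ r → MaybeAll.All (AvoidsDomain ∘ proj₂) (C.startR r)
    startR-avoids r with r ≤ᵇ z
    ... | true  = τ-avoids r
    ... | false = σ-avoids (y + (r ∸ z))

    follow-avoids : ∀ f acc l → AvoidsDomain l → MaybeAll.All ((_≤ z) ∘ proj₂) (C.follow f acc l)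
    follow-avoids f       acc (inj₁ r) r≤z = just r≤z
    follow-avoids zero    acc (inj₂ g) _   = nothing
    follow-avoids (suc f) acc (inj₂ g) _ with C.stepG g | stepG-avoids g
    ... | nothing      | _            = nothing
    ... | just (w , l) | just avoids  = follow-avoids f (acc ++ w) l avoids

    pathFrom-bounded : ∀ {r} → r ≤ z + x → MaybeAll.All (λ e → src e ≤ z + x × tgt e ≤ z) (C.pathFrom r)
    pathFrom-bounded {r} r≤ with C.startR r | startR-avoids r
    ... | nothing      | _           = nothing
    ... | just (w , l) | just avoids with C.follow (suc y) w l | follow-avoids (suc y) w l avoids
    ...   | nothing         | _          = nothing
    ...   | just (w′ , r′)  | just r′≤z  = just (r≤ , r′≤z)

    compose-bounded : All (λ e → src e ≤ z + x × tgt e ≤ z) (edges (compose x y z σ τ))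
    compose-bounded = All.mapMaybe⁺ (All.map⁺ (All.map pathFrom-bounded (range1-bounded (z + x))))

  length-compose : ∀ x y z (σ τ : Multiword {T}) → length (edges (compose x y z σ τ)) ≤ z + x
  length-compose x y z σ τ =
    ≤-trans (List.length-mapMaybe (Compose.pathFrom x y z σ τ) (range1 (z + x))) (≤-reflexive (length-range1 (z + x)))

tensorB-map : ∀ {m n} (B : Fin n → Boundary) (B′ : Fin m → Boundary) (f : Fin m → Fin n) →
              (∀ c → B′ c ≡ B (f c)) → ∀ As → tensorB B′ As ≡ tensorB B (map f As)
tensorB-map B B′ f B′≡B∘f []       = refl
tensorB-map B B′ f B′≡B∘f (A ∷ As) = cong₂ _⊗_ (B′≡B∘f A) (tensorB-map B B′ f B′≡B∘f As)

module _ {t : ℕ} where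

  tensorAll-map : ∀ (G H : Grammar t) (f : Fin (nTypes H) → Fin (nTypes G)) →
                  (∀ c → bnd H c ≡ bnd G (f c)) →
                  ∀ As τs → tensorAll H As τs ≡ tensorAll G (map f As) τs
  tensorAll-map G H f H≡G∘f []       τs       = refl
  tensorAll-map G H f H≡G∘f (A ∷ As) []       = refl
  tensorAll-map G H f H≡G∘f (A ∷ As) (τ ∷ τs) =
    trans (cong₂ (λ a b → tensor 0 a 0 b τ (tensorAll H As τs))
                 (cong size (H≡G∘f A)) (cong size (tensorB-map (bnd G) (bnd H) f H≡G∘f As)))
          (cong (tensor 0 _ 0 _ τ) (tensorAll-map G H f H≡G∘f As τs))

  module _ (G : Grammar t) where

    tensorAll-shape-cong : ∀ As {τs τs′} → Pointwise SameShape τs τs′ →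
                           SameShape (tensorAll G As τs) (tensorAll G As τs′)
    tensorAll-shape-cong []       _           = refl
    tensorAll-shape-cong (A ∷ As) []          = refl
    tensorAll-shape-cong (A ∷ As) {τ ∷ τs} {τ′ ∷ τs′} (τ≈ ∷ τs≈) =
      tensor-shape-cong 0 _ 0 _ τ τ′ (tensorAll G As τs) (tensorAll G As τs′) τ≈ (tensorAll-shape-cong As τs≈)

    tensorAll-bounded : ∀ {As τs} → Pointwise (λ A → TargetsWithin (size (bnd G A))) As τs →
                        TargetsWithin (size (tensorB (bnd G) As)) (tensorAll G As τs)
    tensorAll-bounded []                       = []
    tensorAll-bounded {A ∷ As} {τ ∷ τs} (τ≤ ∷ τs≤) =
      tensor-bounded 0 _ 0 _ τ (tensorAll G As τs) τ≤ (tensorAll-bounded τs≤)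

    mutual
      Gen-bounded : ∀ {A σ} → Gen G A σ → TargetsWithin (size (bnd G A)) σ
      Gen-bounded (gen p _ τs gs) =
        All.map proj₂ (compose-bounded 0 _ _ (tensorAll G (args p) τs) (cow p) (tensorAll-bounded (Gen-boundedᴾ gs)))

      Gen-boundedᴾ : ∀ {As τs} → Pointwise (Gen G) As τs →
                     Pointwise (λ A → TargetsWithin (size (bnd G A))) As τs
      Gen-boundedᴾ []       = []
      Gen-boundedᴾ (g ∷ gs) = Gen-bounded g ∷ Gen-boundedᴾ gs

module Refinement {t : ℕ} (G : Grammar t) where

  n : ℕ
  n = nTypes G

  B : Fin n → Boundary
  B = bnd G

  Shape : Set
  Shape = List (Edge {Fin t})

  _≟ˢ_ : DecidableEquality Shape
  _≟ˢ_ = List.≡-dec (Product.≡-dec ℕ._≟_ (Product.≡-dec (List.≡-dec Fin._≟_) ℕ._≟_))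

  maxSize : ℕ
  maxSize = max 0 (map (size ∘ B) (allFin n))

  size≤maxSize : ∀ A → size (B A) ≤ maxSize
  size≤maxSize A = All.lookup (xs≤max 0 (map (size ∘ B) (allFin n))) (∈-map⁺ (size ∘ B) (∈-allFin A))

  unlabelledEdges : List (Edge {Fin t})
  unlabelledEdges = cartesianProductWith (λ i j → (i , [] , j)) (upTo (suc maxSize)) (upTo (suc maxSize))

  -- abstract, as unfolding this list makes type checking intractable
  abstract
    shapes : List Shape
    shapes = concatMap (λ k → map toList (vectors k unlabelledEdges)) (upTo (suc maxSize))

    ∈-shapes : ∀ es → length es ≤ maxSize → All (λ e → src e ≤ maxSize × tgt e ≤ maxSize) es → shape es ∈ shapes
    ∈-shapes es len≤maxSize bounded = ∈-concatMap⁺ words (lose (∈-upTo⁺ (s≤s shape≤maxSize)) shape∈words)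
      where
      words : ℕ → List Shape
      words k = map toList (vectors k unlabelledEdges)
      shape≤maxSize : length (shape es) ≤ maxSize
      shape≤maxSize = subst (_≤ maxSize) (sym (List.length-map unlabel es)) len≤maxSize
      unlabelled∈ : ∀ {e} → src e ≤ maxSize × tgt e ≤ maxSize → unlabel e ∈ unlabelledEdges
      unlabelled∈ {i , w , j} (i≤maxSize , j≤maxSize) =
        ∈-cartesianProductWith⁺ (λ i j → (i , [] , j)) (∈-upTo⁺ (s≤s i≤maxSize)) (∈-upTo⁺ (s≤s j≤maxSize))
      shape∈words : shape es ∈ words (length (shape es))
      shape∈words = subst (_∈ words (length (shape es))) (Vec.toList∘fromList (shape es))
        (∈-map⁺ toList (∈-vectors (VecAll.fromList⁺ (All.map⁺ (All.map (λ {e} → unlabelled∈ {e}) bounded)))))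

  M : ℕ
  M = length shapes

  indexOfShape : Shape → Maybe (Fin M)
  indexOfShape = indexOf _≟ˢ_ shapes

  -- A type of G′ is a pair (A , j) of a type of G and a position in shapes, encoded by combine.
  base : Fin (n * M) → Fin n
  base c = proj₁ (remQuot {n} M c)

  shapeIndex : Fin (n * M) → Fin M
  shapeIndex c = proj₂ (remQuot {n} M c)

  base-combine : ∀ A j → base (combine A j) ≡ A
  base-combine A j = cong proj₁ (Fin.remQuot-combine {n} {M} A j)

  shapeIndex-combine : ∀ A j → shapeIndex (combine A j) ≡ j
  shapeIndex-combine A j = cong proj₂ (Fin.remQuot-combine {n} {M} A j)

  B′ : Fin (n * M) → Boundary
  B′ = B ∘ base

  refineArgs : (As : List (Fin n)) → Vec (Fin M) (length As) → List (Fin (n * M))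
  refineArgs []       []       = []
  refineArgs (A ∷ As) (j ∷ js) = combine A j ∷ refineArgs As js

  base-refineArgs : ∀ As js → map base (refineArgs As js) ≡ As
  base-refineArgs []       []       = refl
  base-refineArgs (A ∷ As) (j ∷ js) = cong₂ _∷_ (base-combine A j) (base-refineArgs As js)

  tensorB-refineArgs : ∀ As js → tensorB B′ (refineArgs As js) ≡ tensorB B As
  tensorB-refineArgs As js =
    trans (tensorB-map B B′ base (λ _ → refl) (refineArgs As js)) (cong (tensorB B) (base-refineArgs As js))

  Prod : Set
  Prod = Production t n B

  apply : Prod → List (Multiword {Fin t}) → Multiword {Fin t}
  apply p τs = compose 0 (size (tensorB B (args p))) (size (B (target p))) (tensorAll G (args p) τs) (cow p)

  representative : Fin (n * M) → Multiword {Fin t}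
  representative c = mkMW (lookup shapes (shapeIndex c)) []

  targetShape : (p : Prod) → Vec (Fin M) (length (args p)) → Shape
  targetShape p js = shape (edges (apply p (map representative (refineArgs (args p) js))))

  refine : (p : Prod) → Vec (Fin M) (length (args p)) → Fin M → Production t (n * M) B′
  refine p js j = record
    { args   = refineArgs (args p) js
    ; target = combine (target p) j
    ; cow    = cow p
    ; isCow  = subst₂ (λ X Y → IsCowordism X Y (cow p))
                 (sym (tensorB-refineArgs (args p) js)) (cong B (sym (base-combine (target p) j))) (isCow p)
    }

  refinements : Prod → List (Production t (n * M) B′)
  refinements p = mapMaybe (λ js → Maybe.map (refine p js) (indexOfShape (targetShape p js)))
                           (vectors (length (args p)) (allFin M))

  startShape : Shape
  startShape = (1 , [] , 2) ∷ []

  startShape∈shapes : startShape ∈ shapes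
  startShape∈shapes = ∈-shapes startShape (≤-trans (s≤s z≤n) two≤maxSize) ((≤-trans (s≤s z≤n) two≤maxSize , two≤maxSize) ∷ [])
    where
    two≤maxSize : 2 ≤ maxSize
    two≤maxSize = subst (_≤ maxSize) (startSize G) (size≤maxSize (start G))

  j₀ : Fin M
  j₀ = proj₁ (indexOf-complete _≟ˢ_ startShape∈shapes)

  indexOfShape-startShape : indexOfShape startShape ≡ just j₀
  indexOfShape-startShape = proj₂ (indexOf-complete _≟ˢ_ startShape∈shapes)

  G′ : Grammar t
  G′ = record
    { nTypes    = n * M
    ; bnd       = B′
    ; prods     = concatMap refinements (prods G)
    ; start     = combine (start G) j₀
    ; startSize = trans (cong (size ∘ B) (base-combine (start G) j₀)) (startSize G)
    ; start1    = trans (cong (λ A → isLeft (B A) 1) (base-combine (start G) j₀)) (start1 G)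
    ; start2    = trans (cong (λ A → isLeft (B A) 2) (base-combine (start G) j₀)) (start2 G)
    }

  ∈-prods′⁺ : ∀ {p js j} → p ∈ prods G → indexOfShape (targetShape p js) ≡ just j →
              refine p js j ∈ prods G′
  ∈-prods′⁺ {p} {js} p∈ idx = ∈-concatMap⁺ refinements (lose p∈
    (∈-mapMaybe⁺ _ (∈-vectors (VecAll.universal ∈-allFin js)) (cong (Maybe.map (refine p js)) idx)))

  data IsRefinement : Production t (n * M) B′ → Set where
    refinement : ∀ {p js j} → p ∈ prods G → indexOfShape (targetShape p js) ≡ just j →
                 IsRefinement (refine p js j)

  ∈-prods′⁻ : ∀ {p′} → p′ ∈ prods G′ → IsRefinement p′
  ∈-prods′⁻ p′∈ with find (∈-concatMap⁻ refinements {xs = prods G} p′∈)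
  ... | p , p∈ , p′∈refinements
      with ∈-mapMaybe⁻ (λ js → Maybe.map (refine p js) (indexOfShape (targetShape p js)))
                       (vectors (length (args p)) (allFin M)) p′∈refinements
  ...   | js , _ , eq with indexOfShape (targetShape p js) in idx | eq
  ...     | just j | refl = refinement p∈ idx

  apply′ : Production t (n * M) B′ → List (Multiword {Fin t}) → Multiword {Fin t}
  apply′ p′ τs = compose 0 (size (tensorB B′ (args p′))) (size (B′ (target p′))) (tensorAll G′ (args p′) τs) (cow p′)

  apply-refine : ∀ p js j τs → apply′ (refine p js j) τs ≡ apply p τs
  apply-refine p js j τs =
    compose-cong (cong size (tensorB-refineArgs (args p) js)) (cong (size ∘ B) (base-combine (target p) j))
      (trans (tensorAll-map G G′ base (λ _ → refl) (refineArgs (args p) js) τs)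
             (cong (λ As → tensorAll G As τs) (base-refineArgs (args p) js)))
    where
    compose-cong : ∀ {y y′ z z′ μ μ′} → y ≡ y′ → z ≡ z′ → μ ≡ μ′ → compose 0 y z μ (cow p) ≡ compose 0 y′ z′ μ′ (cow p)
    compose-cong refl refl refl = refl

  apply-shape : ∀ p js {τs} → Pointwise SameShape (map representative (refineArgs (args p) js)) τs →
                shape (edges (apply p τs)) ≡ targetShape p js
  apply-shape p js {τs} reps≈τs =
    sym (compose-shape-cong 0 (size (tensorB B (args p))) (size (B (target p)))
           (tensorAll G (args p) (map representative (refineArgs (args p) js))) (tensorAll G (args p) τs)
           (cow p) (cow p) (tensorAll-shape-cong G (args p) reps≈τs) refl)

  apply-shape∈shapes : ∀ p {τs} → Pointwise (Gen G) (args p) τs → shape (edges (apply p τs)) ∈ shapes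
  apply-shape∈shapes p {τs} gs =
    ∈-shapes _ (≤-trans (length-compose 0 y z μ (cow p)) z+0≤maxSize)
      (All.map (λ {e} → bound {e}) (compose-bounded 0 y z μ (cow p) (tensorAll-bounded G (Gen-boundedᴾ G gs))))
    where
    y = size (tensorB B (args p))
    z = size (B (target p))
    μ = tensorAll G (args p) τs
    z+0≤maxSize : z + 0 ≤ maxSize
    z+0≤maxSize = subst (_≤ maxSize) (sym (+-identityʳ z)) (size≤maxSize (target p))
    bound : ∀ {e} → src e ≤ z + 0 × tgt e ≤ z → src e ≤ maxSize × tgt e ≤ maxSize
    bound (src≤ , tgt≤) = ≤-trans src≤ z+0≤maxSize , ≤-trans tgt≤ (size≤maxSize (target p))

  representative-shape : ∀ {c} τ → shape (edges τ) ≡ lookup shapes (shapeIndex c) → SameShape (representative c) τ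
  representative-shape {c} τ τ-shape = begin
    shape (lookup shapes (shapeIndex c))  ≡⟨ cong shape τ-shape ⟨
    shape (shape (edges τ))               ≡⟨ shape-idem (edges τ) ⟩
    shape (edges τ)                       ∎

  refinement-shape : ∀ {p′ τs} → IsRefinement p′ → Pointwise SameShape (map representative (args p′)) τs →
                     shape (edges (apply′ p′ τs)) ≡ lookup shapes (shapeIndex (target p′))
  refinement-shape {τs = τs} (refinement {p} {js} {j} _ idx) reps≈τs = begin
    shape (edges (apply′ (refine p js j) τs))          ≡⟨ cong (shape ∘ edges) (apply-refine p js j τs) ⟩
    shape (edges (apply p τs))                          ≡⟨ apply-shape p js reps≈τs ⟩
    targetShape p js                                    ≡⟨ lookup-indexOf _≟ˢ_ shapes idx ⟨
    lookup shapes j                                     ≡⟨ cong (lookup shapes) (shapeIndex-combine (target p) j) ⟨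
    lookup shapes (shapeIndex (combine (target p) j))   ∎

  mutual
    Gen′-shape : ∀ {c σ} → Gen G′ c σ → shape (edges σ) ≡ lookup shapes (shapeIndex c)
    Gen′-shape (gen p′ p′∈ τs gs) = refinement-shape (∈-prods′⁻ p′∈) (Gen′-shapeᴾ gs)

    Gen′-shapeᴾ : ∀ {cs τs} → Pointwise (Gen G′) cs τs → Pointwise SameShape (map representative cs) τs
    Gen′-shapeᴾ []       = []
    Gen′-shapeᴾ {τs = τ ∷ _} (g ∷ gs) = representative-shape τ (Gen′-shape g) ∷ Gen′-shapeᴾ gs

  -- j is the position indexOfShape finds, not just any position holding the shape: lift-start relies on it.
  mutual
    lift : ∀ {A σ} → Gen G A σ → ∃ λ j → Gen G′ (combine A j) σ × indexOfShape (shape (edges σ)) ≡ just j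
    lift (gen p p∈ τs gs) with liftᴾ gs
    ... | js , gs′ =
      j , subst (Gen G′ _) (apply-refine p js j τs) (gen (refine p js j) (∈-prods′⁺ p∈ idx) τs gs′)
        , trans (cong (indexOfShape) σ-shape) idx
      where
      σ-shape : shape (edges (apply p τs)) ≡ targetShape p js
      σ-shape = apply-shape p js (Gen′-shapeᴾ gs′)
      found = indexOf-complete _≟ˢ_ (subst (_∈ shapes) σ-shape (apply-shape∈shapes p gs))
      j = proj₁ found
      idx = proj₂ found

    liftᴾ : ∀ {As τs} → Pointwise (Gen G) As τs →
            Σ (Vec (Fin M) (length As)) λ js → Pointwise (Gen G′) (refineArgs As js) τs
    liftᴾ []       = [] , []
    liftᴾ (g ∷ gs) = let j , g′ , _ = lift g ; js , gs′ = liftᴾ gs in j ∷ js , g′ ∷ gs′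

  refinement-project : ∀ {p′ τs} → IsRefinement p′ → Pointwise (Gen G) (map base (args p′)) τs →
                       Gen G (base (target p′)) (apply′ p′ τs)
  refinement-project {τs = τs} (refinement {p} {js} {j} p∈ _) gs =
    subst₂ (Gen G) (sym (base-combine (target p) j)) (sym (apply-refine p js j τs))
      (gen p p∈ τs (subst (λ As → Pointwise (Gen G) As τs) (base-refineArgs (args p) js) gs))

  mutual
    project : ∀ {c σ} → Gen G′ c σ → Gen G (base c) σ
    project (gen p′ p′∈ τs gs) = refinement-project (∈-prods′⁻ p′∈) (projectᴾ gs)

    projectᴾ : ∀ {cs τs} → Pointwise (Gen G′) cs τs → Pointwise (Gen G) (map base cs) τs
    projectᴾ []       = []
    projectᴾ (g ∷ gs) = project g ∷ projectᴾ gs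

  simple : Simple G′
  simple c σ σ′ g g′ refl refl = ↭-reflexive Pat-edges , [] , [] , ↭-refl
    where
    Pat-edges : edges (Pat σ) ≡ edges (Pat σ′)
    Pat-edges = begin
      edges (Pat σ)                      ≡⟨ edges-Pat σ ⟩
      shape (edges σ)                    ≡⟨ Gen′-shape g ⟩
      lookup shapes (shapeIndex c)       ≡⟨ Gen′-shape g′ ⟨
      shape (edges σ′)                   ≡⟨ edges-Pat σ′ ⟨
      edges (Pat σ′)                     ∎

  lift-start : ∀ {σ} → Gen G (start G) σ → shape (edges σ) ≡ startShape → Gen G′ (start G′) σ
  lift-start {σ} g σ-shape =
    let j , g′ , idx = lift g
        j≡j₀ = just-injective (trans (sym idx) (trans (cong (indexOfShape) σ-shape) indexOfShape-startShape))
    in subst (λ j → Gen G′ (combine (start G) j) σ) j≡j₀ g′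

  language-preserved : ∀ w → InLanguage G w ⇔ InLanguage G′ w
  language-preserved w = mk⇔ to from
    where
    to : InLanguage G w → InLanguage G′ w
    to (σ , g , σ≈w) = σ , lift-start g (↭.↭-singleton-inv (↭.map⁺ unlabel (proj₁ σ≈w))) , σ≈w
    from : InLanguage G′ w → InLanguage G w
    from (σ , g′ , σ≈w) = σ , subst (λ A → Gen G A σ) (base-combine (start G) j₀) (project g′) , σ≈w

mainTheorem11 : (t : ℕ) (G : Grammar t) →
    Σ (Grammar t) λ G' → Simple G' × ((w : List (Fin t)) → InLanguage G w ⇔ InLanguage G' w)
mainTheorem11 t G = G′ , simple , language-preserved
  where open Refinement G
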